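{- Let $C(a,b)=a^4+36a^2b^2+432b^4$, $A(a,b)=(-3a^2-36b^2)C(a,b)$ and $B(a,b)=(2a^5+72a^3b^2+864ab^4)C(a,b)$. For every prime $\ell\notin\{2,3\}$ and all $(a,b)\in\mathbb{Z}^2$: $\ell^4\mid A(a,b)$ and $\ell^6\mid B(a,b)$ if and only if $\ell^4\mid C(a,b)$. -}

module Defs where

open import Data.Integer using (ℤ; +_; _+_; _*_; -_; _^_)

C : ℤ → ℤ → ℤ
C a b = a ^ 4 + (+ 36) * (a ^ 2) * (b ^ 2) + (+ 432) * (b ^ 4)

A : ℤ → ℤ → ℤ
A a b = (- ((+ 3) * (a ^ 2)) + - ((+ 36) * (b ^ 2))) * C a b

B : ℤ → ℤ → ℤ
B a b = ((+ 2) * (a ^ 5) + (+ 72) * (a ^ 3) * (b ^ 2) + (+ 864) * a * (b ^ 4)) * C a b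

-- With S = a² + 12b² one has A = −3·S·C, B = 2a·C² and C = S(S + 12b²) + 144b⁴, and C is
-- homogeneous of degree 4.  If ℓ⁴ ∣ C, then ℓ⁴ ∣ A and ℓ⁶ ∣ ℓ⁸ ∣ C² ∣ B.  Conversely, if ℓ ∤ S then
-- ℓ⁴ ∣ −3SC forces ℓ⁴ ∣ C since ℓ ∤ 3.  If ℓ ∣ S, then ℓ ∣ B gives ℓ ∣ a or ℓ ∣ C; together with
-- ℓ ∣ S and ℓ ∤ 6 either case yields ℓ ∣ a and ℓ ∣ b, whence ℓ⁴ ∣ C by homogeneity.
module Submission where

open import Defs
open import Data.Nat using (ℕ)
open import Data.Nat.Primality using (Prime)
open import Data.Integer using (ℤ; +_; _^_)
open import Data.Product using (_×_)
open import Relation.Binary.PropositionalEquality using (_≢_)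
open import Function.Bundles using (_⇔_)

open import Data.Nat as ℕ using (zero; suc; _<_; s≤s; z≤n)
import Data.Nat.Divisibility as ℕ
import Data.Nat.Properties as ℕ
open import Data.Nat.Primality using (euclidsLemma; ¬prime[0]; ¬prime[1]; prime⇒nonZero)
import Data.Integer as ℤ
open import Data.Integer using (_+_; _*_; -_)
open import Data.Integer.Properties
  using (abs-*; *-comm; *-assoc; *-identityʳ; ^-identityʳ; ^-distribˡ-+-*; ^-*-assoc)
open import Data.Integer.Solver using (module +-*-Solver)
open import Data.Empty using (⊥-elim)
open import Data.Product using (_,_)
open import Data.Sum as Sum using (_⊎_; [_,_]′)
open import Function.Base using (_∘_; id)
open import Function.Bundles using (mk⇔)
open import Relation.Nullary using (¬_; yes; no; contradiction)
open import Relation.Binary.PropositionalEquality using (_≡_; refl; sym; trans; subst)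

prime∧≢2∧≢3⇒3< : ∀ {p} → Prime p → p ≢ 2 → p ≢ 3 → 3 < p
prime∧≢2∧≢3⇒3< {0} p-prime _ _ = contradiction p-prime ¬prime[0]
prime∧≢2∧≢3⇒3< {1} p-prime _ _ = contradiction p-prime ¬prime[1]
prime∧≢2∧≢3⇒3< {2} _ p≢2 _ = contradiction refl p≢2
prime∧≢2∧≢3⇒3< {3} _ _ p≢3 = contradiction refl p≢3
prime∧≢2∧≢3⇒3< {suc (suc (suc (suc _)))} _ _ _ = s≤s (s≤s (s≤s (s≤s z≤n)))

S : ℤ → ℤ → ℤ
S a b = a ^ 2 + + 12 * b ^ 2

module Identities where
  open +-*-Solver

  -- C and S as solver expressions: their semantics unfold definitionally to C and S.
  Cₚ : ∀ {n} → Polynomial n → Polynomial n → Polynomial n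
  Cₚ a b = a :^ 4 :+ con (+ 36) :* a :^ 2 :* b :^ 2 :+ con (+ 432) :* b :^ 4

  Sₚ : ∀ {n} → Polynomial n → Polynomial n → Polynomial n
  Sₚ a b = a :^ 2 :+ con (+ 12) :* b :^ 2

  A≡-3SC : ∀ a b → A a b ≡ - + 3 * S a b * C a b
  A≡-3SC = solve 2 (λ a b →
    (:- (con (+ 3) :* a :^ 2) :+ :- (con (+ 36) :* b :^ 2)) :* Cₚ a b
      := :- con (+ 3) :* Sₚ a b :* Cₚ a b) refl

  B≡2aC² : ∀ a b → B a b ≡ + 2 * a * C a b ^ 2
  B≡2aC² = solve 2 (λ a b →
    (con (+ 2) :* a :^ 5 :+ con (+ 72) :* a :^ 3 :* b :^ 2 :+ con (+ 864) :* a :* b :^ 4) :* Cₚ a b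
      := con (+ 2) :* a :* Cₚ a b :^ 2) refl

  C≡S[S+12b²]+144b⁴ : ∀ a b → C a b ≡ S a b * (S a b + + 12 * b ^ 2) + + 144 * b ^ 4
  C≡S[S+12b²]+144b⁴ = solve 2 (λ a b →
    Cₚ a b := Sₚ a b :* (Sₚ a b :+ con (+ 12) :* b :^ 2) :+ con (+ 144) :* b :^ 4) refl

  C-homogeneous : ∀ x y k → C (x * k) (y * k) ≡ C x y * k ^ 4
  C-homogeneous = solve 3 (λ x y k → Cₚ (x :* k) (y :* k) := Cₚ x y :* k :^ 4) refl

open Identities using (A≡-3SC; B≡2aC²; C≡S[S+12b²]+144b⁴; C-homogeneous)

-- The argument uses signed divisibility, whose witness is an integer quotient: unlike the
-- statement's unsigned relation (divisibility of absolute values in ℕ), its implicit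
-- arguments can be inferred and a divisor hypothesis can be matched against.
module WithSignedDivisibility where
  open import Data.Integer.Divisibility.Signed

  *-pres-∣ : ∀ {k l i j} → k ∣ i → l ∣ j → k * l ∣ i * j
  *-pres-∣ {k} {j = j} k∣i l∣j = ∣-trans (*-monoʳ-∣ k l∣j) (*-monoˡ-∣ j k∣i)

  ^-monoˡ-∣ : ∀ {i j} n → i ∣ j → i ^ n ∣ j ^ n
  ^-monoˡ-∣ zero    i∣j = ∣-refl
  ^-monoˡ-∣ (suc n) i∣j = *-pres-∣ i∣j (^-monoˡ-∣ n i∣j)

  i^m∣i^[m+n] : ∀ i m n → i ^ m ∣ i ^ (m ℕ.+ n)
  i^m∣i^[m+n] i m n = divides (i ^ n) (trans (^-distribˡ-+-* i m n) (*-comm (i ^ m) (i ^ n)))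

  ∣a∧∣b⇒^4∣C : ∀ {k a b} → k ∣ a → k ∣ b → k ^ 4 ∣ C a b
  ∣a∧∣b⇒^4∣C {k} (divides x refl) (divides y refl) = divides (C x y) (C-homogeneous x y k)

  ^4∣C⇒^4∣A : ∀ k a b → k ^ 4 ∣ C a b → k ^ 4 ∣ A a b
  ^4∣C⇒^4∣A k a b k⁴∣C = subst (k ^ 4 ∣_) (sym (A≡-3SC a b)) (∣n⇒∣m*n (- + 3 * S a b) k⁴∣C)

  ^4∣C⇒^6∣B : ∀ k a b → k ^ 4 ∣ C a b → k ^ 6 ∣ B a b
  ^4∣C⇒^6∣B k a b k⁴∣C = begin
    k ^ 6                 ∣⟨ i^m∣i^[m+n] k 6 2 ⟩
    k ^ 8                 ≡⟨ ^-*-assoc k 4 2 ⟨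
    (k ^ 4) ^ 2           ∣⟨ ^-monoˡ-∣ 2 k⁴∣C ⟩
    C a b ^ 2             ∣⟨ ∣n⇒∣m*n (+ 2 * a) ∣-refl ⟩
    + 2 * a * C a b ^ 2   ≡⟨ B≡2aC² a b ⟨
    B a b                 ∎
    where open ∣-Reasoning

  module PrimeDivisor {p} (p-prime : Prime p) where

    prime∣*⇒∣⊎∣ : ∀ {i j} → + p ∣ i * j → + p ∣ i ⊎ + p ∣ j
    prime∣*⇒∣⊎∣ {i} {j} p∣ij = Sum.map ∣ᵤ⇒∣ ∣ᵤ⇒∣
      (euclidsLemma ℤ.∣ i ∣ ℤ.∣ j ∣ p-prime (subst (p ℕ.∣_) (abs-* i j) (∣⇒∣ᵤ p∣ij)))

    prime∤* : ∀ {i j} → ¬ + p ∣ i → ¬ + p ∣ j → ¬ + p ∣ i * j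
    prime∤* p∤i p∤j = [ p∤i , p∤j ]′ ∘ prime∣*⇒∣⊎∣

    prime∤m∧∣m*n⇒∣n : ∀ {i j} → ¬ + p ∣ i → + p ∣ i * j → + p ∣ j
    prime∤m∧∣m*n⇒∣n p∤i = [ ⊥-elim ∘ p∤i , id ]′ ∘ prime∣*⇒∣⊎∣

    prime∣m^[1+n]⇒∣m : ∀ {i} n → + p ∣ i ^ suc n → + p ∣ i
    prime∣m^[1+n]⇒∣m {i} zero    p∣i¹ = subst (+ p ∣_) (^-identityʳ i) p∣i¹
    prime∣m^[1+n]⇒∣m     (suc n) p∣iⁿ⁺² = [ id , prime∣m^[1+n]⇒∣m n ]′ (prime∣*⇒∣⊎∣ p∣iⁿ⁺²)

    prime∤m∧pᵏ∣m*n⇒pᵏ∣n : ∀ {i j} k → ¬ + p ∣ i → (+ p) ^ k ∣ i * j → (+ p) ^ k ∣ j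
    prime∤m∧pᵏ∣m*n⇒pᵏ∣n {j = j} zero _ _ = divides j (sym (*-identityʳ j))
    prime∤m∧pᵏ∣m*n⇒pᵏ∣n {i} (suc k) p∤i pᵏ⁺¹∣ij
      with prime∤m∧∣m*n⇒∣n p∤i (∣-trans (∣m⇒∣m*n ((+ p) ^ k) ∣-refl) pᵏ⁺¹∣ij)
    ... | divides q refl = begin
      + p * (+ p) ^ k  ∣⟨ *-monoʳ-∣ (+ p) (prime∤m∧pᵏ∣m*n⇒pᵏ∣n k p∤i pᵏ∣iq) ⟩
      + p * q          ≡⟨ *-comm (+ p) q ⟩
      q * + p          ∎
      where
      open ∣-Reasoning
      instance _ = prime⇒nonZero p-prime
      pᵏ∣iq : (+ p) ^ k ∣ i * q
      pᵏ∣iq = *-cancelˡ-∣ (+ p)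
        (subst ((+ p) ^ suc k ∣_) (trans (sym (*-assoc i q (+ p))) (*-comm (i * q) (+ p))) pᵏ⁺¹∣ij)

  module _ {ℓ} (ℓ-prime : Prime ℓ) (3<ℓ : 3 < ℓ) where
    open PrimeDivisor ℓ-prime

    ℓ∤2 : ¬ + ℓ ∣ + 2
    ℓ∤2 = ℕ.>⇒∤ (ℕ.<-trans (ℕ.n<1+n 2) 3<ℓ) ∘ ∣⇒∣ᵤ

    ℓ∤3 : ¬ + ℓ ∣ + 3
    ℓ∤3 = ℕ.>⇒∤ 3<ℓ ∘ ∣⇒∣ᵤ

    ℓ∤-3 : ¬ + ℓ ∣ - + 3
    ℓ∤-3 = ℓ∤3 ∘ ∣m⇒∣-m

    ℓ∤12 : ¬ + ℓ ∣ + 12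
    ℓ∤12 = prime∤* ℓ∤2 (prime∤* ℓ∤2 ℓ∤3)

    ℓ∤144 : ¬ + ℓ ∣ + 144
    ℓ∤144 = prime∤* ℓ∤12 ℓ∤12

    ℓ∣S∧ℓ∣a⇒ℓ∣b : ∀ a b → + ℓ ∣ S a b → + ℓ ∣ a → + ℓ ∣ b
    ℓ∣S∧ℓ∣a⇒ℓ∣b a b ℓ∣S ℓ∣a =
      prime∣m^[1+n]⇒∣m 1 (prime∤m∧∣m*n⇒∣n ℓ∤12 (∣m+n∣m⇒∣n ℓ∣S (∣m⇒∣m*n (a ^ 1) ℓ∣a)))

    ℓ∣S∧ℓ∣b⇒ℓ∣a : ∀ a b → + ℓ ∣ S a b → + ℓ ∣ b → + ℓ ∣ a
    ℓ∣S∧ℓ∣b⇒ℓ∣a a b ℓ∣S ℓ∣b =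
      prime∣m^[1+n]⇒∣m 1 (∣m+n∣n⇒∣m ℓ∣S (∣n⇒∣m*n (+ 12) (∣m⇒∣m*n (b ^ 1) ℓ∣b)))

    ℓ∣S∧ℓ∣C⇒ℓ∣b : ∀ a b → + ℓ ∣ S a b → + ℓ ∣ C a b → + ℓ ∣ b
    ℓ∣S∧ℓ∣C⇒ℓ∣b a b ℓ∣S ℓ∣C = prime∣m^[1+n]⇒∣m 3 (prime∤m∧∣m*n⇒∣n ℓ∤144 (∣m+n∣m⇒∣n
      (subst (+ ℓ ∣_) (C≡S[S+12b²]+144b⁴ a b) ℓ∣C) (∣m⇒∣m*n (S a b + + 12 * b ^ 2) ℓ∣S)))

    ℓ∣B⇒ℓ∣a⊎ℓ∣C : ∀ a b → + ℓ ∣ B a b → + ℓ ∣ a ⊎ + ℓ ∣ C a b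
    ℓ∣B⇒ℓ∣a⊎ℓ∣C a b ℓ∣B = Sum.map (prime∤m∧∣m*n⇒∣n ℓ∤2) (prime∣m^[1+n]⇒∣m 1)
      (prime∣*⇒∣⊎∣ (subst (+ ℓ ∣_) (B≡2aC² a b) ℓ∣B))

    ℓ⁴∣A∧ℓ⁶∣B⇒ℓ⁴∣C : ∀ a b → (+ ℓ) ^ 4 ∣ A a b → (+ ℓ) ^ 6 ∣ B a b → (+ ℓ) ^ 4 ∣ C a b
    ℓ⁴∣A∧ℓ⁶∣B⇒ℓ⁴∣C a b ℓ⁴∣A ℓ⁶∣B with + ℓ ∣? S a b
    ... | no ℓ∤S =
      prime∤m∧pᵏ∣m*n⇒pᵏ∣n 4 (prime∤* ℓ∤-3 ℓ∤S) (subst ((+ ℓ) ^ 4 ∣_) (A≡-3SC a b) ℓ⁴∣A)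
    ... | yes ℓ∣S = ∣a∧∣b⇒^4∣C ℓ∣a ℓ∣b
      where
      ℓ∣b : + ℓ ∣ b
      ℓ∣b = [ ℓ∣S∧ℓ∣a⇒ℓ∣b a b ℓ∣S , ℓ∣S∧ℓ∣C⇒ℓ∣b a b ℓ∣S ]′
        (ℓ∣B⇒ℓ∣a⊎ℓ∣C a b (∣-trans (∣m⇒∣m*n ((+ ℓ) ^ 5) ∣-refl) ℓ⁶∣B))
      ℓ∣a : + ℓ ∣ a
      ℓ∣a = ℓ∣S∧ℓ∣b⇒ℓ∣a a b ℓ∣S ℓ∣b

open WithSignedDivisibility using (^4∣C⇒^4∣A; ^4∣C⇒^6∣B; ℓ⁴∣A∧ℓ⁶∣B⇒ℓ⁴∣C)
open import Data.Integer.Divisibility using (_∣_)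
open import Data.Integer.Divisibility.Signed using (∣ᵤ⇒∣; ∣⇒∣ᵤ)

lemma4p1 : (ℓ : ℕ) → Prime ℓ → ℓ ≢ 2 → ℓ ≢ 3 → (a b : ℤ) →
    (((+ ℓ) ^ 4 ∣ A a b) × ((+ ℓ) ^ 6 ∣ B a b)) ⇔ ((+ ℓ) ^ 4 ∣ C a b)
lemma4p1 ℓ ℓ-prime ℓ≢2 ℓ≢3 a b = mk⇔
  (λ (ℓ⁴∣A , ℓ⁶∣B) → ∣⇒∣ᵤ (ℓ⁴∣A∧ℓ⁶∣B⇒ℓ⁴∣C ℓ-prime 3<ℓ a b (∣ᵤ⇒∣ ℓ⁴∣A) (∣ᵤ⇒∣ ℓ⁶∣B)))
  (λ ℓ⁴∣C → ∣⇒∣ᵤ (^4∣C⇒^4∣A (+ ℓ) a b (∣ᵤ⇒∣ ℓ⁴∣C)) , ∣⇒∣ᵤ (^4∣C⇒^6∣B (+ ℓ) a b (∣ᵤ⇒∣ ℓ⁴∣C)))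
  where
  3<ℓ : 3 < ℓ
  3<ℓ = prime∧≢2∧≢3⇒3< ℓ-prime ℓ≢2 ℓ≢3
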